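{- Let $q\ge0$, $t\ge1$, $k\ge1$ be integers. The critical group $K(W_k(q,t))$ is isomorphic to a direct product of at most two cyclic groups.
   Context: $W_k(q,t)$ is the directed multigraph with hub $v_0$ and rim vertices $v_1,\dots,v_k$ (clockwise, indices mod $k$), with $t$ edges each way between $v_0$ and each $v_i$, one edge $v_i\to v_{i-1}$ and $q$ edges $v_i\to v_{i+1}$. Its critical group $K(W_k(q,t))$ (dollar game with bank $v_0$) is isomorphic to $\mathbb{Z}^k/\overline{M}_k\mathbb{Z}^k$, where $\overline{M}_1=[t]$, $\overline{M}_2=\begin{pmatrix}1+q+t&-1-q\\-1-q&1+q+t\end{pmatrix}$, and for $k\ge3$ $\overline{M}_k$ is the $k\times k$ matrix with diagonal entries $1+q+t$, entries $(i,i+1\bmod k)$ equal to $-q$, entries $(i,i-1\bmod k)$ equal to $-1$, and all other entries $0$. -}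

module Defs where

open import Level using (0ℓ)
open import Data.Nat as ℕ using (ℕ; zero; suc)
open import Data.Nat.DivMod using (_%_)
open import Data.Integer using (ℤ; +_; _+_; _-_; _*_; -_; -1ℤ; 0ℤ)
open import Data.Integer.Divisibility using (_∣_)
open import Data.Fin using (Fin; toℕ)
import Data.Fin as F
open import Data.Product using (_×_; _,_; ∃)
open import Relation.Binary.PropositionalEquality using (_≡_)
open import Relation.Nullary using (does)
open import Data.Bool using (if_then_else_)
open import Algebra.Bundles.Raw using (RawGroup)

Vecℤ : ℕ → Set
Vecℤ k = Fin k → ℤ

Matℤ : ℕ → Set
Matℤ k = Fin k → Fin k → ℤ

Σℤ : (n : ℕ) → (Fin n → ℤ) → ℤ
Σℤ zero    f = 0ℤ
Σℤ (suc n) f = f F.zero + Σℤ n (λ i → f (F.suc i))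

_·_ : ∀ {k} → Matℤ k → Vecℤ k → Vecℤ k
(M · y) i = Σℤ _ (λ j → M i j * y j)

-- the reduced Laplacian  M̄_k  of W_k(q,t)
Mbar : (k q t : ℕ) → Matℤ k
Mbar zero q t ()
Mbar (suc zero) q t i j = + t
Mbar (suc (suc zero)) q t i j =
  if does (toℕ i ℕ.≟ toℕ j) then + (1 ℕ.+ q ℕ.+ t) else - + (1 ℕ.+ q)
Mbar (suc (suc (suc n))) q t i j =
  if does (toℕ j ℕ.≟ toℕ i) then + (1 ℕ.+ q ℕ.+ t)
  else if does (toℕ j ℕ.≟ (toℕ i ℕ.+ 1) % k) then - (+ q)
  else if does (toℕ j ℕ.≟ (toℕ i ℕ.+ (k ℕ.∸ 1)) % k) then -1ℤ
  else 0ℤ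
  where k = suc (suc (suc n))

-- the critical group  K(W_k(q,t)) ≅ ℤ^k / M̄_k ℤ^k, as a setoid-based group:
-- carrier ℤ^k, with x ≈ y iff x - y lies in the column lattice M̄_k ℤ^k
CriticalGroup : (k q t : ℕ) → RawGroup 0ℓ 0ℓ
CriticalGroup k q t = record
  { Carrier = Vecℤ k
  ; _≈_     = λ x y → ∃ λ (z : Vecℤ k) → ∀ i → x i - y i ≡ (Mbar k q t · z) i
  ; _∙_     = λ x y i → x i + y i
  ; ε       = λ _ → 0ℤ
  ; _⁻¹     = λ x i → - x i
  }

-- the cyclic group ℤ/nℤ (n = 0 gives the infinite cyclic group ℤ)
Cyclic : ℕ → RawGroup 0ℓ 0ℓ
Cyclic n = record
  { Carrier = ℤ
  ; _≈_     = λ x y → + n ∣ (x - y)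
  ; _∙_     = _+_
  ; ε       = 0ℤ
  ; _⁻¹     = -_
  }

_⊗_ : RawGroup 0ℓ 0ℓ → RawGroup 0ℓ 0ℓ → RawGroup 0ℓ 0ℓ
G ⊗ H = record
  { Carrier = G.Carrier × H.Carrier
  ; _≈_     = λ { (a , b) (c , d) → (a G.≈ c) × (b H.≈ d) }
  ; _∙_     = λ { (a , b) (c , d) → (a G.∙ c , b H.∙ d) }
  ; ε       = G.ε , H.ε
  ; _⁻¹     = λ { (a , b) → (a G.⁻¹ , b H.⁻¹) }
  }
  where module G = RawGroup G
        module H = RawGroup H

RawGroupCarrier : RawGroup 0ℓ 0ℓ → Set
RawGroupCarrier G = RawGroup.Carrier G

-- Let c = 1 + q + t. A weight sequence with s (m + 2) = c s (m + 1) - q s m is orthogonal,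
-- after summation by parts, to every interior row of M̄, so the functional v ↦ Σᵢ vᵢ sᵢ sends
-- M̄ z to a combination of two boundary quantities of z. The two solutions with initial
-- values (1, 0) and (0, 1) therefore give a map Φ : ℤᵏ → ℤ², onto, under which M̄ ℤᵏ is
-- exactly the preimage of N ℤ² for an explicit 2 × 2 matrix N; the converse inclusion is
-- back-substitution through the rows of M̄ from the top. (For k = 1, 2 one takes
-- N = diag(t, 1) and N = M̄₂.) Hence K(W_k(q,t)) ≅ ℤ² / N ℤ², and Euclid's algorithm
-- brings N to Smith normal form diag(d₁, d₂), giving ℤ/d₁ × ℤ/d₂.

module Submission where

open import Defs
open import Data.Nat as ℕ using (ℕ; zero; suc; _∸_; z≤n; s≤s; _≥_)
import Data.Nat.Properties as ℕP
import Data.Nat.Divisibility as ℕD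
import Data.Nat.GCD as ℕG
open import Data.Nat.DivMod using (_%_; m<n⇒m%n≡m; n%n≡0; [m+n]%n≡m%n; m%n<n)
open import Data.Integer as ℤ using (ℤ; +_; -[1+_]; _+_; _-_; _*_; -_; 0ℤ; 1ℤ; -1ℤ; ∣_∣)
import Data.Integer.Properties as ℤP
import Data.Integer.Divisibility as ℤU
open import Data.Integer.Divisibility.Signed
  using (_∣_; divides; _∣?_; ∣-trans; m∣∣m∣; ∣m∣∣m; ∣⇒∣ᵤ; ∣ᵤ⇒∣; ∣m∣n⇒∣m+n)
open import Data.Integer.Tactic.RingSolver using (solve-∀)
open import Data.Fin as F using (Fin; toℕ)
import Data.Fin.Properties as FP
open import Data.Product using (∃; ∃₂; Σ; _×_; _,_; proj₁; proj₂)
open import Data.Bool using (if_then_else_; true; false; T)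
open import Data.Unit using (tt)
open import Data.Empty using (⊥-elim)
open import Relation.Nullary using (does; yes; no; ¬_)
open import Relation.Binary.PropositionalEquality
open import Algebra.Properties.Semiring.Sum ℤP.+-*-semiring
  using (sum; sum-cong-≗; ∑-distrib-+; sum-init-last; sum-replicate-zero; *-distribˡ-sum)
open import Algebra.Morphism.Structures using (module GroupMorphisms)

cong₃ : ∀ {A B C D : Set} (f : A → B → C → D) {x x′ y y′ z z′} →
  x ≡ x′ → y ≡ y′ → z ≡ z′ → f x y z ≡ f x′ y′ z′
cong₃ f refl refl refl = refl

Σℤ≡sum : ∀ n (f : Fin n → ℤ) → Σℤ n f ≡ sum f
Σℤ≡sum zero    f = refl
Σℤ≡sum (suc n) f = cong (λ r → f F.zero + r) (Σℤ≡sum n (λ i → f (F.suc i)))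

Σℕ : ℕ → (ℕ → ℤ) → ℤ
Σℕ n G = sum {n} (λ i → G (toℕ i))

Σℕ-cong : ∀ n {G H : ℕ → ℤ} → (∀ a → a ℕ.< n → G a ≡ H a) → Σℕ n G ≡ Σℕ n H
Σℕ-cong n eq = sum-cong-≗ (λ i → eq (toℕ i) (FP.toℕ<n i))

Σℕ-zero : ∀ n → Σℕ n (λ _ → 0ℤ) ≡ 0ℤ
Σℕ-zero n = sum-replicate-zero n

Σℕ-init-last : ∀ n (G : ℕ → ℤ) → Σℕ (suc n) G ≡ Σℕ n G + G n
Σℕ-init-last n G = trans (sum-init-last {n} (λ i → G (toℕ i)))
  (cong₂ _+_ (sum-cong-≗ {n} (λ i → cong G (FP.toℕ-inject₁ i))) (cong G (FP.toℕ-fromℕ n)))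

Σℕ-linear : ∀ n x y w (F G H : ℕ → ℤ) →
  Σℕ n (λ a → x * F a + y * G a + w * H a) ≡ x * Σℕ n F + y * Σℕ n G + w * Σℕ n H
Σℕ-linear n x y w F G H = begin
    Σℕ n (λ a → x * F a + y * G a + w * H a)
  ≡⟨ ∑-distrib-+ {n} (λ i → x * F (toℕ i) + y * G (toℕ i)) (λ i → w * H (toℕ i)) ⟩
    Σℕ n (λ a → x * F a + y * G a) + Σℕ n (λ a → w * H a)
  ≡⟨ cong (_+ Σℕ n (λ a → w * H a)) (∑-distrib-+ {n} (λ i → x * F (toℕ i)) (λ i → y * G (toℕ i))) ⟩
    Σℕ n (λ a → x * F a) + Σℕ n (λ a → y * G a) + Σℕ n (λ a → w * H a)
  ≡⟨ sym (cong₂ _+_ (cong₂ _+_ (*-distribˡ-sum {n} x (λ i → F (toℕ i))) (*-distribˡ-sum {n} y (λ i → G (toℕ i))))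
                     (*-distribˡ-sum {n} w (λ i → H (toℕ i)))) ⟩
    x * Σℕ n F + y * Σℕ n G + w * Σℕ n H
  ∎
  where open ≡-Reasoning

Σℕ-ends : ∀ m (G : ℕ → ℤ) → (∀ a → a ℕ.< m → G (suc a) ≡ 0ℤ) →
  Σℕ (suc (suc m)) G ≡ G 0 + G (suc m)
Σℕ-ends m G inner = begin
    G 0 + Σℕ (suc m) (λ a → G (suc a))
  ≡⟨ cong (λ r → G 0 + r) (Σℕ-init-last m (λ a → G (suc a))) ⟩
    G 0 + (Σℕ m (λ a → G (suc a)) + G (suc m))
  ≡⟨ cong (λ r → G 0 + (r + G (suc m))) (trans (Σℕ-cong m inner) (Σℕ-zero m)) ⟩
    G 0 + (0ℤ + G (suc m))
  ≡⟨ cong (λ r → G 0 + r) (ℤP.+-identityˡ (G (suc m))) ⟩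
    G 0 + G (suc m)
  ∎
  where open ≡-Reasoning

Σℕ-rotate : ∀ m (H : ℕ → ℤ) → Σℕ (suc m) (λ a → H ((a ℕ.+ 1) % suc m)) ≡ Σℕ (suc m) H
Σℕ-rotate m H = begin
    Σℕ (suc m) (λ a → H ((a ℕ.+ 1) % suc m))
  ≡⟨ Σℕ-init-last m (λ a → H ((a ℕ.+ 1) % suc m)) ⟩
    Σℕ m (λ a → H ((a ℕ.+ 1) % suc m)) + H ((m ℕ.+ 1) % suc m)
  ≡⟨ cong₂ _+_ (Σℕ-cong m (λ a a<m → cong H (wrap-< a (s≤s a<m)))) (cong H wrap-top) ⟩
    Σℕ m (λ a → H (suc a)) + H 0
  ≡⟨ ℤP.+-comm _ (H 0) ⟩
    Σℕ (suc m) H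
  ∎
  where
    open ≡-Reasoning
    wrap-< : ∀ a → suc a ℕ.< suc m → (a ℕ.+ 1) % suc m ≡ suc a
    wrap-< a lt = trans (cong (_% suc m) (ℕP.+-comm a 1)) (m<n⇒m%n≡m lt)
    wrap-top : (m ℕ.+ 1) % suc m ≡ 0
    wrap-top = trans (cong (_% suc m) (ℕP.+-comm m 1)) (n%n≡0 (suc m))

-- Lookup at a natural-number index, with junk value 0 past the end.
_!_ : ∀ {k} → Vecℤ k → ℕ → ℤ
_!_ {zero}  x _       = 0ℤ
_!_ {suc k} x zero    = x F.zero
_!_ {suc k} x (suc a) = (λ i → x (F.suc i)) ! a

!-toℕ : ∀ {k} (x : Vecℤ k) (i : Fin k) → x ! toℕ i ≡ x i
!-toℕ {suc k} x F.zero    = refl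
!-toℕ {suc k} x (F.suc i) = !-toℕ (λ j → x (F.suc j)) i

!-tabulate : ∀ {k} (G : ℕ → ℤ) a → a ℕ.< k → (λ (i : Fin k) → G (toℕ i)) ! a ≡ G a
!-tabulate {suc k} G zero    _          = refl
!-tabulate {suc k} G (suc a) (s≤s a<k) = !-tabulate (λ b → G (suc b)) a a<k

!-sub : ∀ {k} (x y : Vecℤ k) a → (λ i → x i - y i) ! a ≡ x ! a - y ! a
!-sub {zero}  x y a       = refl
!-sub {suc k} x y zero    = refl
!-sub {suc k} x y (suc a) = !-sub (λ i → x (F.suc i)) (λ i → y (F.suc i)) a

twoPoint : ℤ → ℤ → ℕ → ℤ
twoPoint p₁ p₂ zero          = p₁
twoPoint p₁ p₂ (suc zero)    = p₂
twoPoint p₁ p₂ (suc (suc _)) = 0ℤ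

spike : ∀ {k} → ℤ → ℤ → Vecℤ k
spike p₁ p₂ i = twoPoint p₁ p₂ (toℕ i)

dot : ∀ {k} → (ℕ → ℤ) → Vecℤ k → ℤ
dot s x = sum (λ i → x i * s (toℕ i))

dot≡Σℕ : ∀ {k} (s : ℕ → ℤ) (x : Vecℤ k) → dot s x ≡ Σℕ k (λ a → x ! a * s a)
dot≡Σℕ {k} s x = sum-cong-≗ {k} (λ i → cong (_* s (toℕ i)) (sym (!-toℕ x i)))

dot-cong : ∀ {k} (s : ℕ → ℤ) {x y : Vecℤ k} → (∀ i → x i ≡ y i) → dot s x ≡ dot s y
dot-cong {k} s eq = sum-cong-≗ {k} (λ i → cong (_* s (toℕ i)) (eq i))

dot-+ : ∀ {k} (s : ℕ → ℤ) (x y : Vecℤ k) → dot s (λ i → x i + y i) ≡ dot s x + dot s y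
dot-+ {k} s x y = trans (sum-cong-≗ {k} (λ i → ℤP.*-distribʳ-+ (s (toℕ i)) (x i) (y i)))
  (∑-distrib-+ {k} (λ i → x i * s (toℕ i)) (λ i → y i * s (toℕ i)))

dot-neg : ∀ {k} (s : ℕ → ℤ) (x : Vecℤ k) → dot s (λ i → - x i) ≡ - dot s x
dot-neg {k} s x = begin
    sum (λ i → - x i * s (toℕ i))
  ≡⟨ sum-cong-≗ {k} (λ i → trans (sym (ℤP.neg-distribˡ-* (x i) (s (toℕ i)))) (sym (ℤP.-1*i≡-i _))) ⟩
    sum (λ i → -1ℤ * (x i * s (toℕ i)))
  ≡⟨ sym (*-distribˡ-sum {k} -1ℤ (λ i → x i * s (toℕ i))) ⟩
    -1ℤ * dot s x
  ≡⟨ ℤP.-1*i≡-i (dot s x) ⟩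
    - dot s x
  ∎
  where open ≡-Reasoning

dot-sub : ∀ {k} (s : ℕ → ℤ) (x y : Vecℤ k) → dot s (λ i → x i - y i) ≡ dot s x - dot s y
dot-sub s x y = trans (dot-+ s x (λ i → - y i)) (cong (λ r → dot s x + r) (dot-neg s y))

dot-low : ∀ m (s : ℕ → ℤ) (x : Vecℤ (suc (suc m))) → (∀ a → a ℕ.< m → x ! suc (suc a) ≡ 0ℤ) →
  dot s x ≡ x ! 0 * s 0 + x ! 1 * s 1
dot-low m s x high = begin
    dot s x
  ≡⟨ dot≡Σℕ s x ⟩
    x ! 0 * s 0 + (x ! 1 * s 1 + Σℕ m (λ a → x ! suc (suc a) * s (suc (suc a))))
  ≡⟨ cong (λ r → x ! 0 * s 0 + (x ! 1 * s 1 + r)) (trans (Σℕ-cong m vanish) (Σℕ-zero m)) ⟩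
    x ! 0 * s 0 + (x ! 1 * s 1 + 0ℤ)
  ≡⟨ cong (λ r → x ! 0 * s 0 + r) (ℤP.+-identityʳ _) ⟩
    x ! 0 * s 0 + x ! 1 * s 1
  ∎
  where
    open ≡-Reasoning
    vanish : ∀ a → a ℕ.< m → x ! suc (suc a) * s (suc (suc a)) ≡ 0ℤ
    vanish a lt = trans (cong (_* s (suc (suc a))) (high a lt)) (ℤP.*-zeroˡ (s (suc (suc a))))

ℤ² : Set
ℤ² = ℤ × ℤ

infixl 6 _+₂_ _-₂_

_+₂_ : ℤ² → ℤ² → ℤ²
(x , y) +₂ (x′ , y′) = x + x′ , y + y′

_-₂_ : ℤ² → ℤ² → ℤ²
(x , y) -₂ (x′ , y′) = x - x′ , y - y′

neg₂ : ℤ² → ℤ²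
neg₂ (x , y) = - x , - y

pick₁ : ∀ x y → x * 1ℤ + y * 0ℤ ≡ x
pick₁ = solve-∀

pick₂ : ∀ x y → x * 0ℤ + y * 1ℤ ≡ y
pick₂ = solve-∀

record Mat₂ : Set where
  constructor mat
  field m₁₁ m₁₂ m₂₁ m₂₂ : ℤ

infixr 7 _⊙_
infixl 7 _*ₘ_

_⊙_ : Mat₂ → ℤ² → ℤ²
mat a b c d ⊙ (x , y) = a * x + b * y , c * x + d * y

_*ₘ_ : Mat₂ → Mat₂ → Mat₂
mat a b c d *ₘ mat e f g h = mat (a * e + b * g) (a * f + b * h) (c * e + d * g) (c * f + d * h)

1ₘ : Mat₂
1ₘ = mat 1ℤ 0ℤ 0ℤ 1ℤ

mat-≡ : ∀ {a b c d a′ b′ c′ d′} → a ≡ a′ → b ≡ b′ → c ≡ c′ → d ≡ d′ → mat a b c d ≡ mat a′ b′ c′ d′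
mat-≡ refl refl refl refl = refl

⊙-*ₘ : ∀ A B p → (A *ₘ B) ⊙ p ≡ A ⊙ (B ⊙ p)
⊙-*ₘ (mat a b c d) (mat e f g h) (x , y) = cong₂ _,_ (assoc a b e f g h x y) (assoc c d e f g h x y)
  where
    assoc : ∀ a b e f g h x y → (a * e + b * g) * x + (a * f + b * h) * y ≡ a * (e * x + f * y) + b * (g * x + h * y)
    assoc = solve-∀

⊙-1ₘ : ∀ p → 1ₘ ⊙ p ≡ p
⊙-1ₘ (x , y) = cong₂ _,_ (unit x y) (unit′ x y)
  where
    unit : ∀ x y → 1ℤ * x + 0ℤ * y ≡ x
    unit = solve-∀
    unit′ : ∀ x y → 0ℤ * x + 1ℤ * y ≡ y
    unit′ = solve-∀

⊙-cancel : ∀ A B → A *ₘ B ≡ 1ₘ → ∀ p → A ⊙ (B ⊙ p) ≡ p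
⊙-cancel A B AB≡1 p = trans (sym (⊙-*ₘ A B p)) (trans (cong (_⊙ p) AB≡1) (⊙-1ₘ p))

⊙-+ : ∀ N p p′ → N ⊙ (p +₂ p′) ≡ N ⊙ p +₂ N ⊙ p′
⊙-+ (mat a b c d) (x , y) (x′ , y′) = cong₂ _,_ (distrib a b x y x′ y′) (distrib c d x y x′ y′)
  where
    distrib : ∀ a b x y x′ y′ → a * (x + x′) + b * (y + y′) ≡ (a * x + b * y) + (a * x′ + b * y′)
    distrib = solve-∀

⊙-neg : ∀ N p → N ⊙ (neg₂ p) ≡ neg₂ (N ⊙ p)
⊙-neg (mat a b c d) (x , y) = cong₂ _,_ (distrib a b x y) (distrib c d x y)
  where
    distrib : ∀ a b x y → a * (- x) + b * (- y) ≡ - (a * x + b * y)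
    distrib = solve-∀

⊙-sub : ∀ N p p′ → N ⊙ (p -₂ p′) ≡ N ⊙ p -₂ N ⊙ p′
⊙-sub N p p′ = trans (⊙-+ N p (neg₂ p′)) (cong (N ⊙ p +₂_) (⊙-neg N p′))

adjugate : Mat₂ → Mat₂
adjugate (mat p q r s) = mat s (- q) (- r) p

adjugate-inverse : ∀ p q r s → p * s - q * r ≡ 1ℤ →
  (mat p q r s *ₘ adjugate (mat p q r s) ≡ 1ₘ) × (adjugate (mat p q r s) *ₘ mat p q r s ≡ 1ₘ)
adjugate-inverse p q r s det =
  mat-≡ (trans (e₁ p q r s) det) (e₂ p q) (e₃ r s) (trans (e₄ p q r s) det) ,
  mat-≡ (trans (e₅ p q r s) det) (e₆ q s) (e₇ p r) (trans (e₈ p q r s) det)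
  where
    e₁ : ∀ p q r s → p * s + q * (- r) ≡ p * s - q * r
    e₁ = solve-∀
    e₂ : ∀ p q → p * (- q) + q * p ≡ 0ℤ
    e₂ = solve-∀
    e₃ : ∀ r s → r * s + s * (- r) ≡ 0ℤ
    e₃ = solve-∀
    e₄ : ∀ p q r s → r * (- q) + s * p ≡ p * s - q * r
    e₄ = solve-∀
    e₅ : ∀ p q r s → s * p + (- q) * r ≡ p * s - q * r
    e₅ = solve-∀
    e₆ : ∀ q s → s * q + (- q) * s ≡ 0ℤ
    e₆ = solve-∀
    e₇ : ∀ p r → (- r) * p + p * r ≡ 0ℤ
    e₇ = solve-∀
    e₈ : ∀ p q r s → (- r) * q + p * s ≡ p * s - q * r
    e₈ = solve-∀

infix 4 _∈Im₂_

_∈Im₂_ : ℤ² → Mat₂ → Set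
p ∈Im₂ N = ∃ λ w → p ≡ N ⊙ w

∈Im₂-refl : ∀ N {p p′} → p ≡ p′ → (p -₂ p′) ∈Im₂ N
∈Im₂-refl (mat a b c d) {x , y} refl = (0ℤ , 0ℤ) , cong₂ _,_ (vanish a b x) (vanish c d y)
  where
    vanish : ∀ a b x → x - x ≡ a * 0ℤ + b * 0ℤ
    vanish = solve-∀

-- Smith normal form of 2 × 2 integer matrices

-- Unsigned divisibility, as in the equivalence of Cyclic d₁ ⊗ Cyclic d₂.
Divides₂ : ℕ → ℕ → ℤ² → Set
Divides₂ d₁ d₂ (x , y) = (+ d₁ ℤU.∣ x) × (+ d₂ ℤU.∣ y)

record SmithForm (N : Mat₂) : Set where
  field
    d₁ d₂  : ℕ
    U U⁻¹  : Mat₂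
    U⊙U⁻¹  : ∀ p → U ⊙ (U⁻¹ ⊙ p) ≡ p
    image⇒ : ∀ w → Divides₂ d₁ d₂ (U ⊙ (N ⊙ w))
    image⇐ : ∀ p → Divides₂ d₁ d₂ (U ⊙ p) → p ∈Im₂ N

smith-diagonal : ∀ a b → SmithForm (mat a 0ℤ 0ℤ b)
smith-diagonal a b = record
  { d₁ = ∣ a ∣ ; d₂ = ∣ b ∣ ; U = 1ₘ ; U⁻¹ = 1ₘ ; U⊙U⁻¹ = λ p → trans (⊙-1ₘ (1ₘ ⊙ p)) (⊙-1ₘ p)
  ; image⇒ = λ (x , y) → subst (Divides₂ ∣ a ∣ ∣ b ∣) (sym (trans (⊙-1ₘ _) (diag a b x y)))
                           (∣⇒∣ᵤ (divides x (ℤP.*-comm a x)) , ∣⇒∣ᵤ (divides y (ℤP.*-comm b y)))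
  ; image⇐ = image⇐ }
  where
    diag : ∀ a b x y → (a * x + 0ℤ * y , 0ℤ * x + b * y) ≡ (a * x , b * y)
    diag a b x y = cong₂ _,_ (drop₁ a x y) (drop₂ b x y)
      where
        drop₁ : ∀ a x y → a * x + 0ℤ * y ≡ a * x
        drop₁ = solve-∀
        drop₂ : ∀ b x y → 0ℤ * x + b * y ≡ b * y
        drop₂ = solve-∀
    image⇐ : ∀ p → Divides₂ ∣ a ∣ ∣ b ∣ (1ₘ ⊙ p) → p ∈Im₂ mat a 0ℤ 0ℤ b
    image⇐ p dvd with subst (Divides₂ ∣ a ∣ ∣ b ∣) (⊙-1ₘ p) dvd
    ... | a∣x , b∣y with ∣ᵤ⇒∣ {a} a∣x | ∣ᵤ⇒∣ {b} b∣y
    ... | divides x x≡ | divides y y≡ = (x , y) ,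
      sym (trans (diag a b x y) (cong₂ _,_ (trans (ℤP.*-comm a x) (sym x≡)) (trans (ℤP.*-comm b y) (sym y≡))))

smith-col : ∀ {N N′} V V′ → V *ₘ V′ ≡ 1ₘ → N *ₘ V ≡ N′ → SmithForm N′ → SmithForm N
smith-col {N} {N′} V V′ VV′≡1 NV≡N′ S = record
  { d₁ = d₁ ; d₂ = d₂ ; U = U ; U⁻¹ = U⁻¹ ; U⊙U⁻¹ = U⊙U⁻¹
  ; image⇒ = λ w → subst (λ p → Divides₂ d₁ d₂ (U ⊙ p)) (N′V′≡N w) (image⇒ (V′ ⊙ w))
  ; image⇐ = λ p dvd → let (w , p≡) = image⇐ p dvd in
      V ⊙ w , trans p≡ (trans (cong (_⊙ w) (sym NV≡N′)) (⊙-*ₘ N V w)) }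
  where
    open SmithForm S
    N′V′≡N : ∀ w → N′ ⊙ (V′ ⊙ w) ≡ N ⊙ w
    N′V′≡N w = begin
      N′ ⊙ (V′ ⊙ w)      ≡⟨ cong (λ M → M ⊙ (V′ ⊙ w)) (sym NV≡N′) ⟩
      (N *ₘ V) ⊙ (V′ ⊙ w) ≡⟨ ⊙-*ₘ N V (V′ ⊙ w) ⟩
      N ⊙ (V ⊙ (V′ ⊙ w))  ≡⟨ cong (N ⊙_) (⊙-cancel V V′ VV′≡1 w) ⟩
      N ⊙ w               ∎
      where open ≡-Reasoning

smith-row : ∀ {N N′} R R′ → R *ₘ R′ ≡ 1ₘ → R′ *ₘ R ≡ 1ₘ → R *ₘ N ≡ N′ → SmithForm N′ → SmithForm N
smith-row {N} {N′} R R′ RR′≡1 R′R≡1 RN≡N′ S = record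
  { d₁ = d₁ ; d₂ = d₂ ; U = U *ₘ R ; U⁻¹ = R′ *ₘ U⁻¹ ; U⊙U⁻¹ = UR⊙R′U⁻¹
  ; image⇒ = λ w → subst (Divides₂ d₁ d₂) (sym (URN≡UN′ w)) (image⇒ w)
  ; image⇐ = λ p dvd → let (w , Rp≡) = image⇐ (R ⊙ p) (subst (Divides₂ d₁ d₂) (⊙-*ₘ U R p) dvd) in
      w , p≡Nw p w Rp≡ }
  where
    open SmithForm S
    open ≡-Reasoning
    URN≡UN′ : ∀ w → (U *ₘ R) ⊙ (N ⊙ w) ≡ U ⊙ (N′ ⊙ w)
    URN≡UN′ w = begin
      (U *ₘ R) ⊙ (N ⊙ w) ≡⟨ ⊙-*ₘ U R (N ⊙ w) ⟩
      U ⊙ (R ⊙ (N ⊙ w))  ≡⟨ cong (U ⊙_) (sym (⊙-*ₘ R N w)) ⟩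
      U ⊙ ((R *ₘ N) ⊙ w) ≡⟨ cong (λ M → U ⊙ (M ⊙ w)) RN≡N′ ⟩
      U ⊙ (N′ ⊙ w)       ∎
    p≡Nw : ∀ p w → R ⊙ p ≡ N′ ⊙ w → p ≡ N ⊙ w
    p≡Nw p w Rp≡ = begin
      p                   ≡⟨ sym (⊙-cancel R′ R R′R≡1 p) ⟩
      R′ ⊙ (R ⊙ p)        ≡⟨ cong (R′ ⊙_) (trans Rp≡ (cong (_⊙ w) (sym RN≡N′))) ⟩
      R′ ⊙ ((R *ₘ N) ⊙ w) ≡⟨ cong (R′ ⊙_) (⊙-*ₘ R N w) ⟩
      R′ ⊙ (R ⊙ (N ⊙ w))  ≡⟨ ⊙-cancel R′ R R′R≡1 (N ⊙ w) ⟩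
      N ⊙ w               ∎
    UR⊙R′U⁻¹ : ∀ p → (U *ₘ R) ⊙ ((R′ *ₘ U⁻¹) ⊙ p) ≡ p
    UR⊙R′U⁻¹ p = begin
      (U *ₘ R) ⊙ ((R′ *ₘ U⁻¹) ⊙ p) ≡⟨ ⊙-*ₘ U R _ ⟩
      U ⊙ (R ⊙ ((R′ *ₘ U⁻¹) ⊙ p))  ≡⟨ cong (λ q → U ⊙ (R ⊙ q)) (⊙-*ₘ R′ U⁻¹ p) ⟩
      U ⊙ (R ⊙ (R′ ⊙ (U⁻¹ ⊙ p)))   ≡⟨ cong (U ⊙_) (⊙-cancel R R′ RR′≡1 (U⁻¹ ⊙ p)) ⟩
      U ⊙ (U⁻¹ ⊙ p)                ≡⟨ U⊙U⁻¹ p ⟩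
      p                            ∎

record Bezout (a b : ℤ) : Set where
  field
    g a′ b′ x y : ℤ
    a≡       : a ≡ a′ * g
    b≡       : b ≡ b′ * g
    identity : x * a + y * b ≡ g

sign-abs : ∀ a → Σ ℤ λ σ → (a ≡ σ * + ∣ a ∣) × (+ ∣ a ∣ ≡ σ * a)
sign-abs (+ n)    = 1ℤ , sym (ℤP.*-identityˡ (+ n)) , sym (ℤP.*-identityˡ (+ n))
sign-abs -[1+ n ] = -1ℤ , sym (ℤP.-1*i≡-i (+ suc n)) , sym (ℤP.-1*i≡-i -[1+ n ])

ℕ-identity⇒ℤ : ∀ d m n x y → d ℕ.+ y ℕ.* n ≡ x ℕ.* m → + x * + m - + y * + n ≡ + d
ℕ-identity⇒ℤ d m n x y eq = begin
    + x * + m - + y * + n           ≡⟨ cong₂ _-_ (sym (ℤP.pos-* x m)) (sym (ℤP.pos-* y n)) ⟩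
    + (x ℕ.* m) - + (y ℕ.* n)       ≡⟨ cong (λ u → + u - + (y ℕ.* n)) (sym eq) ⟩
    + (d ℕ.+ y ℕ.* n) - + (y ℕ.* n) ≡⟨ cong (_- + (y ℕ.* n)) (ℤP.pos-+ d (y ℕ.* n)) ⟩
    + d + + (y ℕ.* n) - + (y ℕ.* n) ≡⟨ cancel (+ d) (+ (y ℕ.* n)) ⟩
    + d                             ∎
  where
    open ≡-Reasoning
    cancel : ∀ d u → d + u - u ≡ d
    cancel = solve-∀

bezout : ∀ a b → Bezout a b
bezout a b = record
  { g = + d ; a′ = σa * + qa ; b′ = σb * + qb ; x = proj₁ xy ; y = proj₁ (proj₂ xy)
  ; a≡ = quotient≡ a σa qa a≡σ|a| (ℕD._∣_.equality d∣a)
  ; b≡ = quotient≡ b σb qb b≡σ|b| (ℕD._∣_.equality d∣b)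
  ; identity = proj₂ (proj₂ xy) }
  where
    d = ℕG.gcd ∣ a ∣ ∣ b ∣
    d∣a = ℕG.gcd[m,n]∣m ∣ a ∣ ∣ b ∣
    d∣b = ℕG.gcd[m,n]∣n ∣ a ∣ ∣ b ∣
    qa = ℕD._∣_.quotient d∣a
    qb = ℕD._∣_.quotient d∣b
    σa = proj₁ (sign-abs a)
    σb = proj₁ (sign-abs b)
    a≡σ|a| = proj₁ (proj₂ (sign-abs a))
    b≡σ|b| = proj₁ (proj₂ (sign-abs b))
    |a|≡σa = proj₂ (proj₂ (sign-abs a))
    |b|≡σb = proj₂ (proj₂ (sign-abs b))
    quotient≡ : ∀ i σ q → i ≡ σ * + ∣ i ∣ → ∣ i ∣ ≡ q ℕ.* d → i ≡ σ * + q * + d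
    quotient≡ i σ q i≡ |i|≡ =
      trans i≡ (trans (cong (λ u → σ * + u) |i|≡)
        (trans (cong (σ *_) (ℤP.pos-* q d)) (sym (ℤP.*-assoc σ (+ q) (+ d)))))
    xy : Σ ℤ λ x → Σ ℤ λ y → x * a + y * b ≡ + d
    xy with ℕG.Bézout.identity (ℕG.gcd-GCD ∣ a ∣ ∣ b ∣)
    ... | ℕG.Bézout.+- x y eq = + x * σa , - (+ y * σb) , (begin
        + x * σa * a + - (+ y * σb) * b  ≡⟨ regroup (+ x) σa a (+ y) σb b ⟩
        + x * (σa * a) - + y * (σb * b)  ≡⟨ cong₂ (λ u v → + x * u - + y * v) (sym |a|≡σa) (sym |b|≡σb) ⟩
        + x * + ∣ a ∣ - + y * + ∣ b ∣    ≡⟨ ℕ-identity⇒ℤ d ∣ a ∣ ∣ b ∣ x y eq ⟩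
        + d                              ∎)
      where
        open ≡-Reasoning
        regroup : ∀ x σa a y σb b → x * σa * a + - (y * σb) * b ≡ x * (σa * a) - y * (σb * b)
        regroup = solve-∀
    ... | ℕG.Bézout.-+ x y eq = - (+ x * σa) , + y * σb , (begin
        - (+ x * σa) * a + + y * σb * b  ≡⟨ regroup (+ x) σa a (+ y) σb b ⟩
        + y * (σb * b) - + x * (σa * a)  ≡⟨ cong₂ (λ u v → + y * u - + x * v) (sym |b|≡σb) (sym |a|≡σa) ⟩
        + y * + ∣ b ∣ - + x * + ∣ a ∣    ≡⟨ ℕ-identity⇒ℤ d ∣ b ∣ ∣ a ∣ y x eq ⟩
        + d                              ∎)
      where
        open ≡-Reasoning
        regroup : ∀ x σa a y σb b → - (x * σa) * a + y * σb * b ≡ y * (σb * b) - x * (σa * a)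
        regroup = solve-∀

bezout-coprime : ∀ {a b} (B : Bezout a b) → Bezout.g B ≢ 0ℤ →
  Bezout.x B * Bezout.a′ B + Bezout.y B * Bezout.b′ B ≡ 1ℤ
bezout-coprime {a} {b} B g≢0 = ℤP.*-cancelˡ-≡ g (x * a′ + y * b′) 1ℤ {{ℤ.≢-nonZero g≢0}} (begin
    g * (x * a′ + y * b′)   ≡⟨ spread g x a′ y b′ ⟩
    x * (a′ * g) + y * (b′ * g) ≡⟨ cong₂ (λ u v → x * u + y * v) (sym a≡) (sym b≡) ⟩
    x * a + y * b           ≡⟨ identity ⟩
    g                       ≡⟨ sym (ℤP.*-identityʳ g) ⟩
    g * 1ℤ                  ∎)
  where
    open Bezout B
    open ≡-Reasoning
    spread : ∀ g x a′ y b′ → g * (x * a′ + y * b′) ≡ x * (a′ * g) + y * (b′ * g)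
    spread = solve-∀

∣-abs-≤ : ∀ {h g} → h ∣ g → g ≢ 0ℤ → ∣ h ∣ ℕ.≤ ∣ g ∣
∣-abs-≤ h∣g g≢0 = ℕD.∣⇒≤ {{ℕ.≢-nonZero (λ |g|≡0 → g≢0 (ℤP.∣i∣≡0⇒i≡0 |g|≡0))}} (∣⇒∣ᵤ h∣g)

∣-nonzero : ∀ {h g} → h ∣ g → g ≢ 0ℤ → h ≢ 0ℤ
∣-nonzero (divides q g≡) g≢0 h≡0 = g≢0 (trans g≡ (trans (cong (q *_) h≡0) (ℤP.*-zeroʳ q)))

record ColumnReduction (a b c d : ℤ) : Set where
  field
    g c′ d′ : ℤ
    g∣a     : g ∣ a
    V V′    : Mat₂
    V*V′    : V *ₘ V′ ≡ 1ₘ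
    reduced : mat a b c d *ₘ V ≡ mat g 0ℤ c′ d′

column-reduce : ∀ a b c d → ColumnReduction a b c d
column-reduce a b c d with Bezout.g (bezout a b) ℤ.≟ 0ℤ
... | yes g≡0 = record
  { g = g ; c′ = c * 1ℤ + d * 0ℤ ; d′ = c * 0ℤ + d * 1ℤ ; g∣a = divides a′ a≡
  ; V = 1ₘ ; V′ = 1ₘ ; V*V′ = refl
  ; reduced = mat-≡ (trans (pick₁ a b) (trans (vanishes a a′ a≡) (sym g≡0)))
                    (trans (pick₂ a b) (vanishes b b′ b≡)) refl refl }
  where
    open Bezout (bezout a b)
    vanishes : ∀ i i′ → i ≡ i′ * g → i ≡ 0ℤ
    vanishes i i′ i≡ = trans i≡ (trans (cong (i′ *_) g≡0) (ℤP.*-zeroʳ i′))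
... | no g≢0 = record
  { g = g ; c′ = c * x + d * y ; d′ = c * (- b′) + d * a′ ; g∣a = divides a′ a≡
  ; V = V ; V′ = adjugate V ; V*V′ = proj₁ (adjugate-inverse x (- b′) y a′ det)
  ; reduced = mat-≡ (trans (swap a x b y) identity)
                    (trans (cong₂ (λ u v → u * (- b′) + v * a′) a≡ b≡) (annihilate a′ b′ g)) refl refl }
  where
    open Bezout (bezout a b)
    V = mat x (- b′) y a′
    det : x * a′ - (- b′) * y ≡ 1ℤ
    det = trans (reorder x a′ b′ y) (bezout-coprime (bezout a b) g≢0)
      where
        reorder : ∀ x a′ b′ y → x * a′ - (- b′) * y ≡ x * a′ + y * b′
        reorder = solve-∀
    swap : ∀ a x b y → a * x + b * y ≡ x * a + y * b
    swap = solve-∀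
    annihilate : ∀ a′ b′ g → a′ * g * (- b′) + b′ * g * a′ ≡ 0ℤ
    annihilate = solve-∀

record RowReduction (g c d : ℤ) : Set where
  field
    h e f : ℤ
    h≢0   : h ≢ 0ℤ
    h<g   : ∣ h ∣ ℕ.< ∣ g ∣
    R R′  : Mat₂
    R*R′  : R *ₘ R′ ≡ 1ₘ
    R′*R  : R′ *ₘ R ≡ 1ₘ
    reduced : R *ₘ mat g 0ℤ c d ≡ mat h e 0ℤ f

row-reduce : ∀ g c d → g ≢ 0ℤ → ¬ g ∣ c → RowReduction g c d
row-reduce g c d g≢0 g∤c = record
  { h = h ; e = y * d ; f = g′ * d ; h≢0 = h≢0
  ; h<g = ℕP.≤∧≢⇒< (∣-abs-≤ h∣g g≢0) (λ |h|≡|g| → g∤c (g∣c |h|≡|g|))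
  ; R = R ; R′ = adjugate R
  ; R*R′ = proj₁ (adjugate-inverse x y (- c′) g′ det) ; R′*R = proj₂ (adjugate-inverse x y (- c′) g′ det)
  ; reduced = mat-≡ identity (e₁₂ x y d)
      (trans (cong₂ (λ u v → (- c′) * u + g′ * v) a≡ b≡) (e₂₁ c′ g′ h)) (e₂₂ c′ g′ d) }
  where
    open Bezout (bezout g c) renaming (g to h; a′ to g′; b′ to c′)
    R = mat x y (- c′) g′
    h∣g : h ∣ g
    h∣g = divides g′ a≡
    h≢0 : h ≢ 0ℤ
    h≢0 = ∣-nonzero h∣g g≢0
    g∣c : ∣ h ∣ ≡ ∣ g ∣ → g ∣ c
    g∣c |h|≡|g| = ∣-trans m∣∣m∣ (subst (_∣ c) (cong +_ |h|≡|g|) (∣-trans ∣m∣∣m (divides c′ b≡)))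
    det : x * g′ - y * (- c′) ≡ 1ℤ
    det = trans (reorder x g′ y c′) (bezout-coprime (bezout g c) h≢0)
      where
        reorder : ∀ x g′ y c′ → x * g′ - y * (- c′) ≡ x * g′ + y * c′
        reorder = solve-∀
    e₁₂ : ∀ x y d → x * 0ℤ + y * d ≡ y * d
    e₁₂ = solve-∀
    e₂₁ : ∀ c′ g′ h → (- c′) * (g′ * h) + g′ * (c′ * h) ≡ 0ℤ
    e₂₁ = solve-∀
    e₂₂ : ∀ c′ g′ d → (- c′) * 0ℤ + g′ * d ≡ g′ * d
    e₂₂ = solve-∀

-- Euclid's algorithm on the first column: unless g ∣ c, a row and then a column operation
-- replace g by a divisor of gcd g c, which is strictly smaller in absolute value.
smith-lowerTriangular : ∀ fuel g c d → g ≢ 0ℤ → ∣ g ∣ ℕ.≤ fuel → SmithForm (mat g 0ℤ c d)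
smith-lowerTriangular zero g c d g≢0 |g|≤0 = ⊥-elim (g≢0 (ℤP.∣i∣≡0⇒i≡0 (ℕP.n≤0⇒n≡0 |g|≤0)))
smith-lowerTriangular (suc fuel) g c d g≢0 |g|≤ with g ∣? c
... | yes (divides e c≡) =
  smith-row R (adjugate R) (proj₁ inv) (proj₂ inv)
    (mat-≡ (e₁₁ g c) (e₁₂ d) (trans (cong (λ u → (- e) * g + 1ℤ * u) c≡) (e₂₁ e g)) (e₂₂ e d))
    (smith-diagonal g d)
  where
    R = mat 1ℤ 0ℤ (- e) 1ℤ
    inv = adjugate-inverse 1ℤ 0ℤ (- e) 1ℤ (det e)
      where
        det : ∀ e → 1ℤ * 1ℤ - 0ℤ * (- e) ≡ 1ℤ
        det = solve-∀
    e₁₁ : ∀ g c → 1ℤ * g + 0ℤ * c ≡ g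
    e₁₁ = solve-∀
    e₁₂ : ∀ d → 1ℤ * 0ℤ + 0ℤ * d ≡ 0ℤ
    e₁₂ = solve-∀
    e₂₁ : ∀ e g → (- e) * g + 1ℤ * (e * g) ≡ 0ℤ
    e₂₁ = solve-∀
    e₂₂ : ∀ e d → (- e) * 0ℤ + 1ℤ * d ≡ d
    e₂₂ = solve-∀
... | no g∤c =
  smith-row R R′ R*R′ R′*R reduced
    (smith-col C.V C.V′ C.V*V′ C.reduced
      (smith-lowerTriangular fuel C.g C.c′ C.d′ (∣-nonzero C.g∣a h≢0)
        (ℕP.≤-pred (ℕP.≤-trans (s≤s (∣-abs-≤ C.g∣a h≢0)) (ℕP.≤-trans h<g |g|≤)))))
  where
    open RowReduction (row-reduce g c d g≢0 g∤c)
    module C = ColumnReduction (column-reduce h e 0ℤ f)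

smithForm : ∀ N → SmithForm N
smithForm (mat a b c d) with column-reduce a b c d
... | C with ColumnReduction.g C ℤ.≟ 0ℤ
...   | no g≢0 = smith-col V V′ V*V′ reduced (smith-lowerTriangular ∣ g ∣ g c′ d′ g≢0 ℕP.≤-refl)
  where open ColumnReduction C
...   | yes g≡0 =
  smith-col V V′ V*V′ (trans reduced (mat-≡ g≡0 refl refl refl))
    (smith-row swap swap refl refl (mat-≡ (e c′) (e d′) (e′ c′) (e′ d′))
      (smith-col C₂.V C₂.V′ C₂.V*V′ (trans C₂.reduced (mat-≡ refl refl bottom₁ bottom₂))
        (smith-diagonal C₂.g 0ℤ)))
  where
    open ColumnReduction C
    swap = mat 0ℤ 1ℤ 1ℤ 0ℤ
    e : ∀ x → 0ℤ * 0ℤ + 1ℤ * x ≡ x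
    e = solve-∀
    e′ : ∀ x → 1ℤ * 0ℤ + 0ℤ * x ≡ 0ℤ
    e′ = solve-∀
    module C₂ = ColumnReduction (column-reduce c′ d′ 0ℤ 0ℤ)
    bottom₁ : C₂.c′ ≡ 0ℤ
    bottom₁ = sym (cong Mat₂.m₂₁ C₂.reduced)
    bottom₂ : C₂.d′ ≡ 0ℤ
    bottom₂ = sym (cong Mat₂.m₂₂ C₂.reduced)

-- Reducing the critical lattice to ℤ²

infix 4 _∈Im_

_∈Im_ : ∀ {k} → Vecℤ k → Matℤ k → Set
v ∈Im M = ∃ λ z → ∀ i → v i ≡ (M · z) i

dot₂ : ∀ {k} → (ℕ → ℤ) → (ℕ → ℤ) → Vecℤ k → ℤ²
dot₂ s₁ s₂ v = dot s₁ v , dot s₂ v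

dot₂-+ : ∀ {k} (s₁ s₂ : ℕ → ℤ) (x y : Vecℤ k) → dot₂ s₁ s₂ (λ i → x i + y i) ≡ dot₂ s₁ s₂ x +₂ dot₂ s₁ s₂ y
dot₂-+ s₁ s₂ x y = cong₂ _,_ (dot-+ s₁ x y) (dot-+ s₂ x y)

dot₂-neg : ∀ {k} (s₁ s₂ : ℕ → ℤ) (x : Vecℤ k) → dot₂ s₁ s₂ (λ i → - x i) ≡ neg₂ (dot₂ s₁ s₂ x)
dot₂-neg s₁ s₂ x = cong₂ _,_ (dot-neg s₁ x) (dot-neg s₂ x)

dot₂-low : ∀ m (s₁ s₂ : ℕ → ℤ) → s₁ 0 ≡ 1ℤ → s₁ 1 ≡ 0ℤ → s₂ 0 ≡ 0ℤ → s₂ 1 ≡ 1ℤ →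
  ∀ (x : Vecℤ (suc (suc m))) → (∀ a → a ℕ.< m → x ! suc (suc a) ≡ 0ℤ) →
  dot₂ s₁ s₂ x ≡ (x ! 0 , x ! 1)
dot₂-low m s₁ s₂ s₁0 s₁1 s₂0 s₂1 x high = cong₂ _,_
  (trans (dot-low m s₁ x high) (trans (cong₂ (λ u v → x ! 0 * u + x ! 1 * v) s₁0 s₁1) (pick₁ (x ! 0) (x ! 1))))
  (trans (dot-low m s₂ x high) (trans (cong₂ (λ u v → x ! 0 * u + x ! 1 * v) s₂0 s₂1) (pick₂ (x ! 0) (x ! 1))))

dot₂-spike : ∀ m (s₁ s₂ : ℕ → ℤ) → s₁ 0 ≡ 1ℤ → s₁ 1 ≡ 0ℤ → s₂ 0 ≡ 0ℤ → s₂ 1 ≡ 1ℤ →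
  ∀ p₁ p₂ → dot₂ s₁ s₂ (spike {suc (suc m)} p₁ p₂) ≡ (p₁ , p₂)
dot₂-spike m s₁ s₂ s₁0 s₁1 s₂0 s₂1 p₁ p₂ = dot₂-low m s₁ s₂ s₁0 s₁1 s₂0 s₂1 (spike p₁ p₂)
  (λ a lt → !-tabulate (twoPoint p₁ p₂) (suc (suc a)) (s≤s (s≤s lt)))

record PlanarReduction (k q t : ℕ) : Set where
  field
    s₁ s₂   : ℕ → ℤ
    N       : Mat₂
    reflect : ∀ v → v ∈Im Mbar k q t → dot₂ s₁ s₂ v ∈Im₂ N
    lift    : ∀ v → dot₂ s₁ s₂ v ∈Im₂ N → v ∈Im Mbar k q t
    section : ∀ p → ∃ λ (v : Vecℤ k) → (dot₂ s₁ s₂ v -₂ p) ∈Im₂ N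

outdeg : ℕ → ℕ → ℤ
outdeg q t = + (1 ℕ.+ q ℕ.+ t)

reduction₁ : ∀ q t → PlanarReduction 1 q t
reduction₁ q t = record
  { s₁ = twoPoint 1ℤ 0ℤ ; s₂ = twoPoint 0ℤ 1ℤ ; N = N
  ; reflect = λ v (z , eq) → (z F.zero , 0ℤ) ,
      cong₂ _,_ (trans (cong (λ x → x * 1ℤ + 0ℤ) (eq F.zero)) (first (+ t) (z F.zero)))
                (second (v F.zero) (z F.zero))
  ; lift = λ v ((w₁ , w₂) , eq) → (λ _ → w₁) ,
      λ { F.zero → trans (sym (unit (v F.zero))) (trans (cong proj₁ eq) (drop (+ t) w₁ w₂)) }
  ; section = λ (p₁ , p₂) → (λ _ → p₁) , (0ℤ , - p₂) , cong₂ _,_ (sec₁ (+ t) p₁ p₂) (sec₂ p₁ p₂) }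
  where
    N = mat (+ t) 0ℤ 0ℤ 1ℤ
    first : ∀ t z → (t * z + 0ℤ) * 1ℤ + 0ℤ ≡ t * z + 0ℤ * 0ℤ
    first = solve-∀
    second : ∀ v z → v * 0ℤ + 0ℤ ≡ 0ℤ * z + 1ℤ * 0ℤ
    second = solve-∀
    unit : ∀ v → v * 1ℤ + 0ℤ ≡ v
    unit = solve-∀
    drop : ∀ t w₁ w₂ → t * w₁ + 0ℤ * w₂ ≡ t * w₁ + 0ℤ
    drop = solve-∀
    sec₁ : ∀ t p₁ p₂ → p₁ * 1ℤ + 0ℤ - p₁ ≡ t * 0ℤ + 0ℤ * (- p₂)
    sec₁ = solve-∀
    sec₂ : ∀ p₁ p₂ → p₁ * 0ℤ + 0ℤ - p₂ ≡ 0ℤ * 0ℤ + 1ℤ * (- p₂)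
    sec₂ = solve-∀

reduction₂ : ∀ q t → PlanarReduction 2 q t
reduction₂ q t = record
  { s₁ = twoPoint 1ℤ 0ℤ ; s₂ = twoPoint 0ℤ 1ℤ ; N = N
  ; reflect = λ v (z , eq) → (z F.zero , z (F.suc F.zero)) ,
      trans (coordinates v) (cong₂ _,_ (trans (eq F.zero) (drop0 (c * z F.zero) (d * z (F.suc F.zero))))
                                       (trans (eq (F.suc F.zero)) (drop0 (d * z F.zero) (c * z (F.suc F.zero)))))
  ; lift = λ v ((w₁ , w₂) , eq) → spike w₁ w₂ , λ where
      F.zero         → trans (cong proj₁ (trans (sym (coordinates v)) eq)) (sym (drop0 (c * w₁) (d * w₂)))
      (F.suc F.zero) → trans (cong proj₂ (trans (sym (coordinates v)) eq)) (sym (drop0 (d * w₁) (c * w₂)))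
  ; section = λ (p₁ , p₂) → spike p₁ p₂ ,
      ∈Im₂-refl N (dot₂-spike 0 (twoPoint 1ℤ 0ℤ) (twoPoint 0ℤ 1ℤ) refl refl refl refl p₁ p₂) }
  where
    c d : ℤ
    c = outdeg q t
    d = - + (1 ℕ.+ q)
    N = mat c d d c
    coordinates : ∀ (v : Vecℤ 2) → dot₂ (twoPoint 1ℤ 0ℤ) (twoPoint 0ℤ 1ℤ) v ≡ (v F.zero , v (F.suc F.zero))
    coordinates v = dot₂-low 0 (twoPoint 1ℤ 0ℤ) (twoPoint 0ℤ 1ℤ) refl refl refl refl v (λ _ ())
    drop0 : ∀ x y → x + (y + 0ℤ) ≡ x + y
    drop0 x y = cong (λ r → x + r) (ℤP.+-identityʳ y)

-- The wheel with k ≥ 3 rim vertices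

δ : ℕ → ℕ → ℤ → ℤ
δ j a v = if does (j ℕ.≟ a) then v else 0ℤ

sum-δ : ∀ k a v (z : Vecℤ k) → sum (λ j → δ (toℕ j) a v * z j) ≡ v * z ! a
sum-δ zero    a       v z = sym (ℤP.*-zeroʳ v)
sum-δ (suc k) zero    v z =
  trans (cong (λ r → v * z F.zero + r) (sum-replicate-zero k)) (ℤP.+-identityʳ _)
sum-δ (suc k) (suc a) v z = trans (ℤP.+-identityˡ _) (sum-δ k a v (λ j → z (F.suc j)))

≡ᵇ-sound : ∀ j a → (j ℕ.≡ᵇ a) ≡ true → j ≡ a
≡ᵇ-sound j a e = ℕP.≡ᵇ⇒≡ j a (subst T (sym e) tt)

δ-split : ∀ j a b d (x y w : ℤ) → a ≢ b → a ≢ d → b ≢ d →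
  (if does (j ℕ.≟ a) then x else if does (j ℕ.≟ b) then y else if does (j ℕ.≟ d) then w else 0ℤ)
  ≡ δ j a x + δ j b y + δ j d w
δ-split j a b d x y w a≢b a≢d b≢d with j ℕ.≡ᵇ a in ja | j ℕ.≡ᵇ b in jb | j ℕ.≡ᵇ d in jd
... | true  | true  | _     = ⊥-elim (a≢b (trans (sym (≡ᵇ-sound j a ja)) (≡ᵇ-sound j b jb)))
... | true  | false | true  = ⊥-elim (a≢d (trans (sym (≡ᵇ-sound j a ja)) (≡ᵇ-sound j d jd)))
... | true  | false | false = sym (trans (ℤP.+-identityʳ _) (ℤP.+-identityʳ _))
... | false | true  | true  = ⊥-elim (b≢d (trans (sym (≡ᵇ-sound j b jb)) (≡ᵇ-sound j d jd)))
... | false | true  | false = sym (trans (ℤP.+-identityʳ _) (ℤP.+-identityˡ _))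
... | false | false | true  = sym (ℤP.+-identityˡ _)
... | false | false | false = refl

linrec : ℤ → ℤ → ℤ → ℤ → ℕ → ℤ
linrec c q s₀ s₁ zero          = s₀
linrec c q s₀ s₁ (suc zero)    = s₁
linrec c q s₀ s₁ (suc (suc m)) = c * linrec c q s₀ s₁ (suc m) - q * linrec c q s₀ s₁ m

module Cycle (n : ℕ) where

  K : ℕ
  K = suc (suc (suc n))

  next prev : ℕ → ℕ
  next a = (a ℕ.+ 1) % K
  prev a = (a ℕ.+ (K ∸ 1)) % K

  next-suc : ∀ a → suc a ℕ.< K → next a ≡ suc a
  next-suc a lt = trans (cong (_% K) (ℕP.+-comm a 1)) (m<n⇒m%n≡m lt)

  next-last : next (suc (suc n)) ≡ 0
  next-last = trans (cong (λ m → suc (suc m) % K) (ℕP.+-comm n 1)) (n%n≡0 K)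

  prev-zero : prev 0 ≡ suc (suc n)
  prev-zero = m<n⇒m%n≡m (ℕP.n<1+n (suc (suc n)))

  prev-suc : ∀ a → suc a ℕ.< K → prev (suc a) ≡ a
  prev-suc a lt = trans (cong (_% K) (sym (ℕP.+-suc a (suc (suc n)))))
    (trans ([m+n]%n≡m%n a K) (m<n⇒m%n≡m (ℕP.<-trans (ℕP.n<1+n a) lt)))

  <K-last : ∀ a → a ℕ.< K → ¬ suc a ℕ.< K → a ≡ suc (suc n)
  <K-last a lt nlt = ℕP.≤-antisym (ℕP.≤-pred lt) (ℕP.≤-pred (ℕP.≤-pred (ℕP.≰⇒> nlt)))

  prev-next : ∀ a → a ℕ.< K → prev (next a) ≡ a
  prev-next a lt with suc a ℕ.<? K
  ... | yes lt′ = trans (cong prev (next-suc a lt′)) (prev-suc a lt′)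
  ... | no nlt  = begin
      prev (next a)             ≡⟨ cong (λ b → prev (next b)) a≡ ⟩
      prev (next (suc (suc n))) ≡⟨ cong prev next-last ⟩
      prev 0                    ≡⟨ prev-zero ⟩
      suc (suc n)               ≡⟨ sym a≡ ⟩
      a                         ∎
    where
      open ≡-Reasoning
      a≡ = <K-last a lt nlt

  data Position : ℕ → Set where
    first  : Position 0
    middle : ∀ a → suc (suc a) ℕ.< K → Position (suc a)
    last   : Position (suc (suc n))

  position : ∀ a → a ℕ.< K → Position a
  position zero    _  = first
  position (suc a) lt with suc (suc a) ℕ.<? K
  ... | yes lt′ = middle a lt′
  ... | no nlt  = subst Position (sym (<K-last (suc a) lt nlt)) last

  neighbours-distinct : ∀ a → a ℕ.< K → (a ≢ next a) × (a ≢ prev a) × (next a ≢ prev a)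
  neighbours-distinct a lt with position a lt
  ... | first =
      (λ e → 0≢1+ (trans e next0)) ,
      (λ e → 0≢1+ (trans e prev-zero)) ,
      (λ e → 0≢1+ (ℕP.suc-injective (trans (sym next0) (trans e prev-zero))))
    where
      0≢1+ : ∀ {m} → 0 ≢ suc m
      0≢1+ ()
      next0 : next 0 ≡ 1
      next0 = next-suc 0 (s≤s (s≤s z≤n))
  ... | middle b lt′ =
      (λ e → ℕP.1+n≢n (sym (trans e nextb))) ,
      (λ e → ℕP.1+n≢n (trans e prevb)) ,
      (λ e → ℕP.m+1+n≢n 1 (trans (sym nextb) (trans e prevb)))
    where
      nextb : next (suc b) ≡ suc (suc b)
      nextb = next-suc (suc b) lt′
      prevb : prev (suc b) ≡ b
      prevb = prev-suc b (ℕP.<-trans (ℕP.n<1+n (suc b)) lt′)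
  ... | last =
      (λ e → ℕP.1+n≢0 (trans e next-last)) ,
      (λ e → ℕP.1+n≢n (trans e prevl)) ,
      (λ e → ℕP.0≢1+n (trans (sym next-last) (trans e prevl)))
    where
      prevl : prev (suc (suc n)) ≡ suc n
      prevl = prev-suc (suc n) (ℕP.n<1+n _)

  Mbar-entry : ∀ q t (i j : Fin K) → Mbar K q t i j ≡
    δ (toℕ j) (toℕ i) (outdeg q t) + δ (toℕ j) (next (toℕ i)) (- + q) + δ (toℕ j) (prev (toℕ i)) -1ℤ
  Mbar-entry q t i j with neighbours-distinct (toℕ i) (FP.toℕ<n i)
  ... | i≢next , i≢prev , next≢prev =
    δ-split (toℕ j) (toℕ i) (next (toℕ i)) (prev (toℕ i)) _ _ _ i≢next i≢prev next≢prev

  Mbar-row : ∀ q t (z : Vecℤ K) (i : Fin K) → let a = toℕ i in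
    (Mbar K q t · z) i ≡ outdeg q t * z ! a - + q * z ! next a - z ! prev a
  Mbar-row q t z i = begin
      Σℤ K (λ j → Mbar K q t i j * z j)
    ≡⟨ Σℤ≡sum K (λ j → Mbar K q t i j * z j) ⟩
      sum (λ j → Mbar K q t i j * z j)
    ≡⟨ sum-cong-≗ {K} (λ j → trans (cong (_* z j) (Mbar-entry q t i j)) (distrib (D j) (N j) (P j) (z j))) ⟩
      sum (λ j → D j * z j + N j * z j + P j * z j)
    ≡⟨ ∑-distrib-+ {K} (λ j → D j * z j + N j * z j) (λ j → P j * z j) ⟩
      sum (λ j → D j * z j + N j * z j) + sum (λ j → P j * z j)
    ≡⟨ cong (_+ sum (λ j → P j * z j)) (∑-distrib-+ {K} (λ j → D j * z j) (λ j → N j * z j)) ⟩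
      sum (λ j → D j * z j) + sum (λ j → N j * z j) + sum (λ j → P j * z j)
    ≡⟨ cong₂ _+_ (cong₂ _+_ (sum-δ K a c z) (sum-δ K (next a) (- + q) z)) (sum-δ K (prev a) -1ℤ z) ⟩
      c * z ! a + (- + q) * z ! next a + -1ℤ * z ! prev a
    ≡⟨ signs c (+ q) (z ! a) (z ! next a) (z ! prev a) ⟩
      c * z ! a - + q * z ! next a - z ! prev a
    ∎
    where
      open ≡-Reasoning
      a = toℕ i
      c = outdeg q t
      D N P : Fin K → ℤ
      D j = δ (toℕ j) a c
      N j = δ (toℕ j) (next a) (- + q)
      P j = δ (toℕ j) (prev a) -1ℤ
      distrib : ∀ d m p u → (d + m + p) * u ≡ d * u + m * u + p * u
      distrib = solve-∀
      signs : ∀ c q x y w → c * x + (- q) * y + -1ℤ * w ≡ c * x - q * y - w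
      signs = solve-∀

  next<K : ∀ a → next a ℕ.< K
  next<K a = m%n<n (a ℕ.+ 1) K

  prev<K : ∀ a → prev a ℕ.< K
  prev<K a = m%n<n (a ℕ.+ (K ∸ 1)) K

  Mbar-row-tabulate : ∀ q t (G : ℕ → ℤ) a → a ℕ.< K →
    (Mbar K q t · (λ i → G (toℕ i))) ! a ≡ outdeg q t * G a - + q * G (next a) - G (prev a)
  Mbar-row-tabulate q t G a a<K = begin
      Mz ! a
    ≡⟨ cong (Mz !_) (sym (FP.toℕ-fromℕ< a<K)) ⟩
      Mz ! toℕ i
    ≡⟨ trans (!-toℕ Mz i) (Mbar-row q t z i) ⟩
      c * z ! toℕ i - + q * z ! next (toℕ i) - z ! prev (toℕ i)
    ≡⟨ cong (λ b → c * z ! b - + q * z ! next b - z ! prev b) (FP.toℕ-fromℕ< a<K) ⟩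
      c * z ! a - + q * z ! next a - z ! prev a
    ≡⟨ cong₃ (λ x y w → c * x - + q * y - w)
             (!-tabulate G a a<K) (!-tabulate G (next a) (next<K a)) (!-tabulate G (prev a) (prev<K a)) ⟩
      c * G a - + q * G (next a) - G (prev a)
    ∎
    where
      open ≡-Reasoning
      c = outdeg q t
      z : Vecℤ K
      z i = G (toℕ i)
      Mz = Mbar K q t · z
      i = F.fromℕ< a<K

  Σℕ-next : ∀ (H : ℕ → ℤ) → Σℕ K (λ a → H (next a)) ≡ Σℕ K H
  Σℕ-next = Σℕ-rotate (suc (suc n))

  -- Summation by parts: move M̄ from z onto the weights s.
  dot-Mbar : ∀ q t (s : ℕ → ℤ) (z : Vecℤ K) →
    dot s (Mbar K q t · z) ≡ Σℕ K (λ a → z ! a * (outdeg q t * s a - + q * s (prev a) - s (next a)))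
  dot-Mbar q t s z = begin
      dot s (Mbar K q t · z)
    ≡⟨ sum-cong-≗ {K} (λ i → cong (_* s (toℕ i)) (Mbar-row q t z i)) ⟩
      Σℕ K (λ a → (c * Z a - Q * Z (next a) - Z (prev a)) * s a)
    ≡⟨ Σℕ-cong K (λ a _ → expand c Q (Z a) (Z (next a)) (Z (prev a)) (s a)) ⟩
      Σℕ K (λ a → c * (Z a * s a) + (- Q) * (Z (next a) * s a) + -1ℤ * (Z (prev a) * s a))
    ≡⟨ Σℕ-linear K c (- Q) -1ℤ (λ a → Z a * s a) (λ a → Z (next a) * s a) (λ a → Z (prev a) * s a) ⟩
      c * Σℕ K (λ a → Z a * s a) + (- Q) * Σℕ K (λ a → Z (next a) * s a) + -1ℤ * Σℕ K (λ a → Z (prev a) * s a)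
    ≡⟨ cong₂ (λ u v → c * Σℕ K (λ a → Z a * s a) + (- Q) * u + -1ℤ * v) shift₊ shift₋ ⟩
      c * Σℕ K (λ a → Z a * s a) + (- Q) * Σℕ K (λ a → Z a * s (prev a)) + -1ℤ * Σℕ K (λ a → Z a * s (next a))
    ≡⟨ sym (Σℕ-linear K c (- Q) -1ℤ (λ a → Z a * s a) (λ a → Z a * s (prev a)) (λ a → Z a * s (next a))) ⟩
      Σℕ K (λ a → c * (Z a * s a) + (- Q) * (Z a * s (prev a)) + -1ℤ * (Z a * s (next a)))
    ≡⟨ Σℕ-cong K (λ a _ → collect c Q (Z a) (s a) (s (prev a)) (s (next a))) ⟩
      Σℕ K (λ a → Z a * (c * s a - Q * s (prev a) - s (next a)))
    ∎
    where
      open ≡-Reasoning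
      c = outdeg q t
      Q = + q
      Z = z !_
      shift₊ : Σℕ K (λ a → Z (next a) * s a) ≡ Σℕ K (λ a → Z a * s (prev a))
      shift₊ = trans (Σℕ-cong K (λ a a<K → cong (λ b → Z (next a) * s b) (sym (prev-next a a<K))))
                     (Σℕ-next (λ a → Z a * s (prev a)))
      shift₋ : Σℕ K (λ a → Z (prev a) * s a) ≡ Σℕ K (λ a → Z a * s (next a))
      shift₋ = trans (sym (Σℕ-next (λ a → Z (prev a) * s a)))
                     (Σℕ-cong K (λ a a<K → cong (λ b → Z b * s (next a)) (prev-next a a<K)))
      expand : ∀ c Q x y w u → (c * x - Q * y - w) * u ≡ c * (x * u) + (- Q) * (y * u) + -1ℤ * (w * u)
      expand = solve-∀
      collect : ∀ c Q x u v w → c * (x * u) + (- Q) * (x * v) + -1ℤ * (x * w) ≡ x * (c * u - Q * v - w)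
      collect = solve-∀

  -- The recurrence kills every interior term, leaving only the rows 0 and K - 1 that wrap around.
  dot-linrec-Mbar : ∀ q t s₀ s₁ (z : Vecℤ K) → let s = linrec (outdeg q t) (+ q) s₀ s₁ in
    dot s (Mbar K q t · z) ≡
      (s K - s₀) * (z ! suc (suc n) - outdeg q t * z ! 0) + (s (suc K) - s₁) * z ! 0
  dot-linrec-Mbar q t s₀ s₁ z = begin
      dot s (Mbar K q t · z)
    ≡⟨ dot-Mbar q t s z ⟩
      Σℕ K term
    ≡⟨ Σℕ-ends (suc n) term interior ⟩
      term 0 + term (suc (suc n))
    ≡⟨ cong₂ (λ u v → Z 0 * (c * s₀ - Q * s u - s v) + term (suc (suc n))) prev-zero (next-suc 0 (s≤s (s≤s z≤n))) ⟩
      Z 0 * (c * s₀ - Q * s (suc (suc n)) - s₁) + term (suc (suc n))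
    ≡⟨ cong₂ (λ u v → Z 0 * (c * s₀ - Q * s (suc (suc n)) - s₁) + Z (suc (suc n)) * (c * s (suc (suc n)) - Q * s u - s v))
             (prev-suc (suc n) (ℕP.n<1+n _)) next-last ⟩
      Z 0 * (c * s₀ - Q * s (suc (suc n)) - s₁) + Z (suc (suc n)) * (c * s (suc (suc n)) - Q * s (suc n) - s₀)
    ≡⟨ boundary c Q (Z 0) (Z (suc (suc n))) s₀ s₁ (s (suc n)) (s (suc (suc n))) ⟩
      (s K - s₀) * (Z (suc (suc n)) - c * Z 0) + (s (suc K) - s₁) * Z 0
    ∎
    where
      open ≡-Reasoning
      c = outdeg q t
      Q = + q
      s = linrec c Q s₀ s₁
      Z = z !_
      term : ℕ → ℤ
      term a = Z a * (c * s a - Q * s (prev a) - s (next a))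
      vanish : ∀ x y → x * (y - y) ≡ 0ℤ
      vanish = solve-∀
      interior : ∀ a → a ℕ.< suc n → term (suc a) ≡ 0ℤ
      interior a lt = trans
        (cong₂ (λ u v → Z (suc a) * (c * s (suc a) - Q * s u - s v))
               (prev-suc a (ℕP.m<n⇒m<1+n (s≤s lt))) (next-suc (suc a) (s≤s (s≤s lt))))
        (vanish (Z (suc a)) (s (suc (suc a))))
      boundary : ∀ c Q z₀ zₗ s₀ s₁ u v →
        z₀ * (c * s₀ - Q * v - s₁) + zₗ * (c * v - Q * u - s₀)
        ≡ ((c * v - Q * u) - s₀) * (zₗ - c * z₀) + ((c * (c * v - Q * u) - Q * v) - s₁) * z₀
      boundary = solve-∀

module CycleReduction (n q t : ℕ) where
  open Cycle n

  c Q : ℤ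
  c = outdeg q t
  Q = + q

  seq : ℤ → ℤ → ℕ → ℤ
  seq = linrec c Q

  -- Row s₀ s₁ of N is (seq s₀ s₁ K - s₀ , seq s₀ s₁ (K + 1) - s₁), as in dot-linrec-Mbar.
  N : Mat₂
  N = mat (seq 1ℤ 0ℤ K - 1ℤ) (seq 1ℤ 0ℤ (suc K) - 0ℤ) (seq 0ℤ 1ℤ K - 0ℤ) (seq 0ℤ 1ℤ (suc K) - 1ℤ)

  Φ : Vecℤ K → ℤ²
  Φ = dot₂ (seq 1ℤ 0ℤ) (seq 0ℤ 1ℤ)

  reflect : ∀ v → v ∈Im Mbar K q t → Φ v ∈Im₂ N
  reflect v (z , v≡Mz) = (z ! suc (suc n) - c * z ! 0 , z ! 0) ,
    cong₂ _,_ (trans (dot-cong (seq 1ℤ 0ℤ) v≡Mz) (dot-linrec-Mbar q t 1ℤ 0ℤ z))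
              (trans (dot-cong (seq 0ℤ 1ℤ) v≡Mz) (dot-linrec-Mbar q t 0ℤ 1ℤ z))

  -- Solve the rows K - 1, K - 2, …, 2 of M̄ z = v from the top down,
  -- given z 0 = w₂ and z (K - 1) = w₁ + c w₂; descend m is z (K - 1 - m).
  descend : Vecℤ K → ℤ → ℤ → ℕ → ℤ
  descend v w₁ w₂ zero          = w₁ + c * w₂
  descend v w₁ w₂ (suc zero)    = c * (w₁ + c * w₂) - Q * w₂ - v ! suc (suc n)
  descend v w₁ w₂ (suc (suc m)) = c * descend v w₁ w₂ (suc m) - Q * descend v w₁ w₂ m - v ! (suc n ∸ m)

  backsolve : Vecℤ K → ℤ → ℤ → ℕ → ℤ
  backsolve v w₁ w₂ zero    = w₂
  backsolve v w₁ w₂ (suc a) = descend v w₁ w₂ (suc n ∸ a)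

  RowHolds : (ℕ → ℤ) → Vecℤ K → ℕ → Set
  RowHolds z v a = c * z a - Q * z (next a) - z (prev a) ≡ v ! a

  private
    peel : ∀ c Q x y w → c * x - Q * y - (c * x - Q * y - w) ≡ w
    peel = solve-∀

  backsolve-last : ∀ v w₁ w₂ → RowHolds (backsolve v w₁ w₂) v (suc (suc n))
  backsolve-last v w₁ w₂ = begin
      c * descend v w₁ w₂ (n ∸ n) - Q * z (next (suc (suc n))) - z (prev (suc (suc n)))
    ≡⟨ cong₃ (λ x y u → c * descend v w₁ w₂ x - Q * z y - z u) (ℕP.n∸n≡0 n) next-last (prev-suc (suc n) (ℕP.n<1+n _)) ⟩
      c * (w₁ + c * w₂) - Q * w₂ - descend v w₁ w₂ (suc n ∸ n)
    ≡⟨ cong (λ x → c * (w₁ + c * w₂) - Q * w₂ - descend v w₁ w₂ x) (ℕP.m+n∸n≡m 1 n) ⟩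
      c * (w₁ + c * w₂) - Q * w₂ - descend v w₁ w₂ 1
    ≡⟨ peel c Q (w₁ + c * w₂) w₂ (v ! suc (suc n)) ⟩
      v ! suc (suc n)
    ∎
    where
      open ≡-Reasoning
      z = backsolve v w₁ w₂

  backsolve-middle : ∀ v w₁ w₂ b m → suc b ℕ.+ m ≡ n → RowHolds (backsolve v w₁ w₂) v (suc (suc b))
  backsolve-middle v w₁ w₂ b m split = begin
      c * d (n ∸ b) - Q * z (next (suc (suc b))) - z (prev (suc (suc b)))
    ≡⟨ cong₃ (λ x y u → c * d x - Q * z y - z u) (trans (cong (_∸ b) (sym split)) (+∸-cancel 1 b m))
             (next-suc (suc (suc b)) below) (prev-suc (suc b) (ℕP.<-trans (ℕP.n<1+n _) below)) ⟩
      c * d (suc m) - Q * d (n ∸ suc b) - d (suc n ∸ b)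
    ≡⟨ cong₂ (λ x y → c * d (suc m) - Q * d x - d y)
             (trans (cong (_∸ suc b) (sym split)) (ℕP.m+n∸m≡n (suc b) m))
             (trans (cong (λ r → suc r ∸ b) (sym split)) (+∸-cancel 2 b m)) ⟩
      c * d (suc m) - Q * d m - d (suc (suc m))
    ≡⟨ peel c Q (d (suc m)) (d m) (v ! (suc n ∸ m)) ⟩
      v ! (suc n ∸ m)
    ≡⟨ cong (λ r → v ! (suc r ∸ m)) (sym split) ⟩
      v ! (suc (suc b) ℕ.+ m ∸ m)
    ≡⟨ cong (v !_) (ℕP.m+n∸n≡m (suc (suc b)) m) ⟩
      v ! suc (suc b)
    ∎
    where
      open ≡-Reasoning
      z = backsolve v w₁ w₂
      d = descend v w₁ w₂
      +∸-cancel : ∀ j a m → j ℕ.+ (a ℕ.+ m) ∸ a ≡ j ℕ.+ m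
      +∸-cancel j a m = trans (ℕP.+-∸-assoc j (ℕP.m≤m+n a m)) (cong (j ℕ.+_) (ℕP.m+n∸m≡n a m))
      below : suc (suc (suc b)) ℕ.< K
      below = s≤s (s≤s (s≤s (subst (suc b ℕ.≤_) split (ℕP.m≤m+n (suc b) m))))

  backsolve-row : ∀ v w₁ w₂ b → suc (suc b) ℕ.< K → RowHolds (backsolve v w₁ w₂) v (suc (suc b))
  backsolve-row v w₁ w₂ b lt with suc (suc (suc b)) ℕ.<? K
  ... | yes lt′ = backsolve-middle v w₁ w₂ b (proj₁ split) (proj₂ split)
    where split = ℕP.m≤n⇒∃[o]m+o≡n (ℕP.≤-pred (ℕP.≤-pred (ℕP.≤-pred lt′)))
  ... | no nlt  = subst (RowHolds (backsolve v w₁ w₂) v) (sym (<K-last _ lt nlt)) (backsolve-last v w₁ w₂)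

  lift : ∀ v → Φ v ∈Im₂ N → v ∈Im Mbar K q t
  lift v ((w₁ , w₂) , Φv≡Nw) = z , λ i →
    sym (ℤP.i-j≡0⇒i≡j ((Mbar K q t · z) i) (v i) (trans (sym (!-toℕ r i)) (r≡0 (toℕ i) (FP.toℕ<n i))))
    where
      open ≡-Reasoning
      Z = backsolve v w₁ w₂
      z : Vecℤ K
      z i = Z (toℕ i)
      r : Vecℤ K
      r i = (Mbar K q t · z) i - v i
      r-high : ∀ a → a ℕ.< suc n → r ! suc (suc a) ≡ 0ℤ
      r-high a lt = begin
          r ! suc (suc a)
        ≡⟨ !-sub (Mbar K q t · z) v (suc (suc a)) ⟩
          (Mbar K q t · z) ! suc (suc a) - v ! suc (suc a)
        ≡⟨ cong (_- v ! suc (suc a)) (trans (Mbar-row-tabulate q t Z (suc (suc a)) (s≤s (s≤s lt)))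
                                             (backsolve-row v w₁ w₂ a (s≤s (s≤s lt)))) ⟩
          v ! suc (suc a) - v ! suc (suc a)
        ≡⟨ ℤP.+-inverseʳ (v ! suc (suc a)) ⟩
          0ℤ
        ∎
      z-last : z ! suc (suc n) ≡ w₁ + c * w₂
      z-last = trans (!-tabulate Z (suc (suc n)) (ℕP.n<1+n _)) (cong (descend v w₁ w₂) (ℕP.n∸n≡0 n))
      dot-r : ∀ s₀ s₁ → dot (seq s₀ s₁) v ≡ (seq s₀ s₁ K - s₀) * w₁ + (seq s₀ s₁ (suc K) - s₁) * w₂ →
        dot (seq s₀ s₁) r ≡ 0ℤ
      dot-r s₀ s₁ dot-v = begin
          dot (seq s₀ s₁) r
        ≡⟨ dot-sub (seq s₀ s₁) (Mbar K q t · z) v ⟩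
          dot (seq s₀ s₁) (Mbar K q t · z) - dot (seq s₀ s₁) v
        ≡⟨ cong₂ _-_ (dot-linrec-Mbar q t s₀ s₁ z) dot-v ⟩
          A * (z ! suc (suc n) - c * z ! 0) + B * z ! 0 - (A * w₁ + B * w₂)
        ≡⟨ cong₂ (λ x y → A * (x - c * y) + B * y - (A * w₁ + B * w₂)) z-last (!-tabulate {K} Z 0 (s≤s z≤n)) ⟩
          A * (w₁ + c * w₂ - c * w₂) + B * w₂ - (A * w₁ + B * w₂)
        ≡⟨ cancel A B c w₁ w₂ ⟩
          0ℤ
        ∎
        where
          A = seq s₀ s₁ K - s₀
          B = seq s₀ s₁ (suc K) - s₁
          cancel : ∀ A B c w₁ w₂ → A * (w₁ + c * w₂ - c * w₂) + B * w₂ - (A * w₁ + B * w₂) ≡ 0ℤ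
          cancel = solve-∀
      r-low : (r ! 0 , r ! 1) ≡ (0ℤ , 0ℤ)
      r-low = trans (sym (dot₂-low (suc n) (seq 1ℤ 0ℤ) (seq 0ℤ 1ℤ) refl refl refl refl r r-high))
        (cong₂ _,_ (dot-r 1ℤ 0ℤ (cong proj₁ Φv≡Nw)) (dot-r 0ℤ 1ℤ (cong proj₂ Φv≡Nw)))
      r≡0 : ∀ a → a ℕ.< K → r ! a ≡ 0ℤ
      r≡0 zero          _  = cong proj₁ r-low
      r≡0 (suc zero)    _  = cong proj₂ r-low
      r≡0 (suc (suc a)) lt = r-high a (ℕP.≤-pred (ℕP.≤-pred lt))

  reduction : PlanarReduction K q t
  reduction = record
    { s₁ = seq 1ℤ 0ℤ ; s₂ = seq 0ℤ 1ℤ ; N = N ; reflect = reflect ; lift = lift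
    ; section = λ p → spike (proj₁ p) (proj₂ p) ,
        ∈Im₂-refl N (dot₂-spike (suc n) (seq 1ℤ 0ℤ) (seq 0ℤ 1ℤ) refl refl refl refl (proj₁ p) (proj₂ p)) }

planarReduction : ∀ k q t → k ≥ 1 → PlanarReduction k q t
planarReduction 1                   q t _ = reduction₁ q t
planarReduction 2                   q t _ = reduction₂ q t
planarReduction (suc (suc (suc n))) q t _ = CycleReduction.reduction n q t

Divides₂-refl : ∀ d₁ d₂ {p p′} → p ≡ p′ → Divides₂ d₁ d₂ (p -₂ p′)
Divides₂-refl d₁ d₂ {x , y} refl =
  ∣⇒∣ᵤ {+ d₁} (divides 0ℤ (ℤP.+-inverseʳ x)) , ∣⇒∣ᵤ {+ d₂} (divides 0ℤ (ℤP.+-inverseʳ y))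

Divides₂-trans : ∀ d₁ d₂ {p p′ p″} →
  Divides₂ d₁ d₂ (p -₂ p′) → Divides₂ d₁ d₂ (p′ -₂ p″) → Divides₂ d₁ d₂ (p -₂ p″)
Divides₂-trans d₁ d₂ {x , y} {x′ , y′} {x″ , y″} (d₁∣x , d₂∣y) (d₁∣x′ , d₂∣y′) =
  telescope-∣ d₁ x x′ x″ d₁∣x d₁∣x′ , telescope-∣ d₂ y y′ y″ d₂∣y d₂∣y′
  where
    telescope : ∀ a b c → a - b + (b - c) ≡ a - c
    telescope = solve-∀
    telescope-∣ : ∀ d a b c → + d ℤU.∣ (a - b) → + d ℤU.∣ (b - c) → + d ℤU.∣ (a - c)
    telescope-∣ d a b c ab bc = ∣⇒∣ᵤ {+ d}
      (subst (+ d ∣_) (telescope a b c) (∣m∣n⇒∣m+n (∣ᵤ⇒∣ {+ d} {a - b} ab) (∣ᵤ⇒∣ {+ d} {b - c} bc)))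

record CyclicCoordinates (k q t d₁ d₂ : ℕ) : Set where
  field
    F       : Vecℤ k → ℤ²
    F-+     : ∀ x y → F (λ i → x i + y i) ≡ F x +₂ F y
    F-neg   : ∀ x → F (λ i → - x i) ≡ neg₂ (F x)
    kernel⇒ : ∀ v → v ∈Im Mbar k q t → Divides₂ d₁ d₂ (F v)
    kernel⇐ : ∀ v → Divides₂ d₁ d₂ (F v) → v ∈Im Mbar k q t
    onto    : ∀ p → ∃ λ v → Divides₂ d₁ d₂ (F v -₂ p)

  F-sub : ∀ x y → F (λ i → x i - y i) ≡ F x -₂ F y
  F-sub x y = trans (F-+ x (λ i → - y i)) (cong (F x +₂_) (F-neg y))

  F-zero : F (λ _ → 0ℤ) ≡ (0ℤ , 0ℤ)
  F-zero = trans (F-sub 0⃗ 0⃗) (cong₂ _,_ (ℤP.+-inverseʳ (proj₁ (F 0⃗))) (ℤP.+-inverseʳ (proj₂ (F 0⃗))))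
    where
      0⃗ : Vecℤ k
      0⃗ _ = 0ℤ

isGroupIsomorphism : ∀ {k q t d₁ d₂} (C : CyclicCoordinates k q t d₁ d₂) →
  GroupMorphisms.IsGroupIsomorphism (CriticalGroup k q t) (Cyclic d₁ ⊗ Cyclic d₂) (CyclicCoordinates.F C)
isGroupIsomorphism {d₁ = d₁} {d₂} C = record
  { isGroupMonomorphism = record
    { isGroupHomomorphism = record
      { isMonoidHomomorphism = record
        { isMagmaHomomorphism = record
          { isRelHomomorphism = record
            { cong = λ {x} {y} x≈y → subst (Divides₂ d₁ d₂) (F-sub x y) (kernel⇒ _ x≈y) }
          ; homo = λ x y → Divides₂-refl d₁ d₂ (F-+ x y) }
        ; ε-homo = Divides₂-refl d₁ d₂ F-zero }
      ; ⁻¹-homo = λ x → Divides₂-refl d₁ d₂ (F-neg x) }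
    ; injective = λ {x} {y} Fx≈Fy → kernel⇐ _ (subst (Divides₂ d₁ d₂) (sym (F-sub x y)) Fx≈Fy) }
  ; surjective = λ p → let (v , Fv≈p) = onto p in
      v , λ {z} z≈v → Divides₂-trans d₁ d₂ {F z} {F v} {p}
                        (subst (Divides₂ d₁ d₂) (F-sub z v) (kernel⇒ _ z≈v)) Fv≈p }
  where open CyclicCoordinates C

cyclicCoordinates : ∀ {k q t} (P : PlanarReduction k q t) (S : SmithForm (PlanarReduction.N P)) →
  CyclicCoordinates k q t (SmithForm.d₁ S) (SmithForm.d₂ S)
cyclicCoordinates {k} {q} {t} P S = record
  { F = λ v → U ⊙ Φ v
  ; F-+ = λ x y → trans (cong (U ⊙_) (dot₂-+ s₁ s₂ x y)) (⊙-+ U (Φ x) (Φ y))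
  ; F-neg = λ x → trans (cong (U ⊙_) (dot₂-neg s₁ s₂ x)) (⊙-neg U (Φ x))
  ; kernel⇒ = λ v v∈ → let (w , Φv≡) = reflect v v∈ in
      subst (λ p → Divides₂ d₁ d₂ (U ⊙ p)) (sym Φv≡) (image⇒ w)
  ; kernel⇐ = λ v dvd → lift v (image⇐ (Φ v) dvd)
  ; onto = onto }
  where
    open PlanarReduction P
    open SmithForm S
    Φ = dot₂ {k} s₁ s₂
    onto : ∀ p → ∃ λ v → Divides₂ d₁ d₂ (U ⊙ Φ v -₂ p)
    onto p with section (U⁻¹ ⊙ p)
    ... | v , w , Φv-p≡Nw = v , subst (Divides₂ d₁ d₂) (begin
        U ⊙ N ⊙ w                    ≡⟨ cong (U ⊙_) (sym Φv-p≡Nw) ⟩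
        U ⊙ (Φ v -₂ U⁻¹ ⊙ p)         ≡⟨ ⊙-sub U (Φ v) (U⁻¹ ⊙ p) ⟩
        U ⊙ Φ v -₂ U ⊙ U⁻¹ ⊙ p       ≡⟨ cong (λ r → U ⊙ Φ v -₂ r) (U⊙U⁻¹ p) ⟩
        U ⊙ Φ v -₂ p                 ∎) (image⇒ w)
      where open ≡-Reasoning

theorem10 : (q t k : ℕ) → t ≥ 1 → k ≥ 1 →
  ∃₂ λ (a b : ℕ) → Σ (RawGroupCarrier (CriticalGroup k q t) → RawGroupCarrier (Cyclic a ⊗ Cyclic b))
    (GroupMorphisms.IsGroupIsomorphism (CriticalGroup k q t) (Cyclic a ⊗ Cyclic b))
theorem10 q t k _ k≥1 = d₁ , d₂ , CyclicCoordinates.F coordinates , isGroupIsomorphism coordinates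
  where
    reduction = planarReduction k q t k≥1
    smith = smithForm (PlanarReduction.N reduction)
    open SmithForm smith using (d₁; d₂)
    coordinates = cyclicCoordinates reduction smith
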